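{- Let $k \geq 0$ be an integer. If $x \in B_k$ and $(1+i)^{k+1}$ divides $x$ in $\mathbb{Z}[i]$, then $x = 0$.
   Context: For $n\ge 0$, $B_n = \left\{ \sum_{j=0}^n v_j (1+i)^j : v_j \in \{0,\pm 1,\pm i\}\right\} \subset \mathbb{Z}[i]$. -}

module Defs where

open import Data.Integer using (ℤ; +_; -_) renaming (_+_ to _+ℤ_; _*_ to _*ℤ_; _-_ to _-ℤ_)
open import Data.Nat using (ℕ; zero; suc)
open import Data.Vec using (Vec; []; _∷_)
open import Data.Product using (Σ; _×_; _,_)
open import Relation.Binary.PropositionalEquality using (_≡_)

record ℤ[i] : Set where
  constructor _+_i
  field
    re : ℤ
    im : ℤ
open ℤ[i] public

0ᵍ : ℤ[i]
0ᵍ = (+ 0) + (+ 0) i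

1ᵍ : ℤ[i]
1ᵍ = (+ 1) + (+ 0) i

_+ᵍ_ : ℤ[i] → ℤ[i] → ℤ[i]
(a + b i) +ᵍ (c + d i) = (a +ℤ c) + (b +ℤ d) i

_*ᵍ_ : ℤ[i] → ℤ[i] → ℤ[i]
(a + b i) *ᵍ (c + d i) = ((a *ℤ c) -ℤ (b *ℤ d)) + ((a *ℤ d) +ℤ (b *ℤ c)) i

ω : ℤ[i]
ω = (+ 1) + (+ 1) i

_^ᵍ_ : ℤ[i] → ℕ → ℤ[i]
z ^ᵍ zero = 1ᵍ
z ^ᵍ suc n = z *ᵍ (z ^ᵍ n)

_∣ᵍ_ : ℤ[i] → ℤ[i] → Set
d ∣ᵍ x = Σ ℤ[i] λ q → x ≡ d *ᵍ q

data Digit : Set where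
  d0 d1 d-1 di d-i : Digit

digitVal : Digit → ℤ[i]
digitVal d0  = (+ 0) + (+ 0) i
digitVal d1  = (+ 1) + (+ 0) i
digitVal d-1 = (- (+ 1)) + (+ 0) i
digitVal di  = (+ 0) + (+ 1) i
digitVal d-i = (+ 0) + (- (+ 1)) i

expandFrom : ℕ → {m : ℕ} → Vec Digit m → ℤ[i]
expandFrom s [] = 0ᵍ
expandFrom s (v ∷ vs) = (digitVal v *ᵍ (ω ^ᵍ s)) +ᵍ expandFrom (suc s) vs

expand : {m : ℕ} → Vec Digit m → ℤ[i]
expand = expandFrom 0

InB : ℕ → ℤ[i] → Set
InB n x = Σ (Vec Digit (suc n)) λ v → expand v ≡ x

{-# OPTIONS --safe #-}
-- Proof idea: ω = 1 + i has norm 2, so ω divides a + b i exactly when a + b is even;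
-- the nonzero digits ±1, ±i have a + b = ±1 and are not divisible by ω. Writing
-- x = v₀ + ω y with y ∈ B_(k-1), divisibility of x by ω^(k+1) forces v₀ = 0, and after
-- cancelling ω we get y divisible by ω^k, so induction on the number of digits gives x = 0.
module Submission where

open import Defs
open import Data.Nat as ℕ using (ℕ; suc)
open import Data.Nat.Divisibility using (_∣_; ∣1⇒≡1; m∣m*n)
open import Data.Integer using (ℤ; +_; ∣_∣) renaming (_+_ to _+ℤ_; _*_ to _*ℤ_; _-_ to _-ℤ_)
open import Data.Integer.Properties using (abs-*; *-cancelˡ-≡; +-identityˡ)
open import Data.Integer.Tactic.RingSolver using (solve-∀)
open import Data.Vec using (Vec; []; _∷_)
open import Data.Product using (_,_)
open import Data.Sum using (_⊎_; inj₁; inj₂)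
open import Data.Empty using (⊥-elim)
open import Relation.Binary.PropositionalEquality
open ≡-Reasoning

n+2a≡2b⇒n≡2[b-a] : ∀ n a b → n +ℤ + 2 *ℤ a ≡ + 2 *ℤ b → n ≡ + 2 *ℤ (b -ℤ a)
n+2a≡2b⇒n≡2[b-a] n a b eq = begin
  n                              ≡⟨ subtract-2a n a ⟩
  (n +ℤ + 2 *ℤ a) -ℤ + 2 *ℤ a    ≡⟨ cong (_-ℤ + 2 *ℤ a) eq ⟩
  + 2 *ℤ b -ℤ + 2 *ℤ a           ≡⟨ factor-2 a b ⟩
  + 2 *ℤ (b -ℤ a)                ∎
  where
  subtract-2a : ∀ n a → n ≡ (n +ℤ + 2 *ℤ a) -ℤ + 2 *ℤ a
  subtract-2a = solve-∀
  factor-2 : ∀ a b → + 2 *ℤ b -ℤ + 2 *ℤ a ≡ + 2 *ℤ (b -ℤ a)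
  factor-2 = solve-∀

∣n∣≡1⇒n≢2*m : ∀ n m → ∣ n ∣ ≡ 1 → n ≢ + 2 *ℤ m
∣n∣≡1⇒n≢2*m n m ∣n∣≡1 n≡2m = 2≢1 (∣1⇒≡1 (subst (2 ∣_) ∣2m∣≡1 (m∣m*n ∣ m ∣)))
  where
  2≢1 : 2 ≢ 1
  2≢1 ()

  ∣2m∣≡1 : 2 ℕ.* ∣ m ∣ ≡ 1
  ∣2m∣≡1 = trans (sym (abs-* (+ 2) m)) (trans (cong ∣_∣ (sym n≡2m)) ∣n∣≡1)

-- The ring solver only sees through the top-level reduct of a goal, so the componentwise
-- identities below are stated with the products of ℤ[i] unfolded.

+i-cong : ∀ {a b c d} → a ≡ c → b ≡ d → (a + b i) ≡ (c + d i)
+i-cong refl refl = refl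

+ᵍ-identityˡ : ∀ z → 0ᵍ +ᵍ z ≡ z
+ᵍ-identityˡ (a + b i) = +i-cong (+-identityˡ a) (+-identityˡ b)

*ᵍ-identityʳ : ∀ z → z *ᵍ 1ᵍ ≡ z
*ᵍ-identityʳ (a + b i) = +i-cong (re-part a b) (im-part a b)
  where
  re-part : ∀ a b → a *ℤ + 1 -ℤ b *ℤ + 0 ≡ a
  re-part = solve-∀
  im-part : ∀ a b → a *ℤ + 0 +ℤ b *ℤ + 1 ≡ b
  im-part = solve-∀

*ᵍ-comm : ∀ z w → z *ᵍ w ≡ w *ᵍ z
*ᵍ-comm (a + b i) (c + d i) = +i-cong (re-part a b c d) (im-part a b c d)
  where
  re-part : ∀ a b c d → a *ℤ c -ℤ b *ℤ d ≡ c *ℤ a -ℤ d *ℤ b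
  re-part = solve-∀
  im-part : ∀ a b c d → a *ℤ d +ℤ b *ℤ c ≡ c *ℤ b +ℤ d *ℤ a
  im-part = solve-∀

*ᵍ-assoc : ∀ z w u → (z *ᵍ w) *ᵍ u ≡ z *ᵍ (w *ᵍ u)
*ᵍ-assoc (a + b i) (c + d i) (e + f i) = +i-cong (re-part a b c d e f) (im-part a b c d e f)
  where
  re-part : ∀ a b c d e f →
    (a *ℤ c -ℤ b *ℤ d) *ℤ e -ℤ (a *ℤ d +ℤ b *ℤ c) *ℤ f
      ≡ a *ℤ (c *ℤ e -ℤ d *ℤ f) -ℤ b *ℤ (c *ℤ f +ℤ d *ℤ e)
  re-part = solve-∀
  im-part : ∀ a b c d e f →
    (a *ℤ c -ℤ b *ℤ d) *ℤ f +ℤ (a *ℤ d +ℤ b *ℤ c) *ℤ e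
      ≡ a *ℤ (c *ℤ f +ℤ d *ℤ e) +ℤ b *ℤ (c *ℤ e -ℤ d *ℤ f)
  im-part = solve-∀

*ᵍ-distribˡ-+ᵍ : ∀ z w u → z *ᵍ (w +ᵍ u) ≡ (z *ᵍ w) +ᵍ (z *ᵍ u)
*ᵍ-distribˡ-+ᵍ (a + b i) (c + d i) (e + f i) = +i-cong (re-part a b c d e f) (im-part a b c d e f)
  where
  re-part : ∀ a b c d e f →
    a *ℤ (c +ℤ e) -ℤ b *ℤ (d +ℤ f) ≡ (a *ℤ c -ℤ b *ℤ d) +ℤ (a *ℤ e -ℤ b *ℤ f)
  re-part = solve-∀
  im-part : ∀ a b c d e f →
    a *ℤ (d +ℤ f) +ℤ b *ℤ (c +ℤ e) ≡ (a *ℤ d +ℤ b *ℤ c) +ℤ (a *ℤ f +ℤ b *ℤ e)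
  im-part = solve-∀

*ᵍ-comm-middle : ∀ z w u → z *ᵍ (w *ᵍ u) ≡ w *ᵍ (z *ᵍ u)
*ᵍ-comm-middle z w u = begin
  z *ᵍ (w *ᵍ u)  ≡⟨ *ᵍ-assoc z w u ⟨
  (z *ᵍ w) *ᵍ u  ≡⟨ cong (_*ᵍ u) (*ᵍ-comm z w) ⟩
  (w *ᵍ z) *ᵍ u  ≡⟨ *ᵍ-assoc w z u ⟩
  w *ᵍ (z *ᵍ u)  ∎

re+im : ℤ[i] → ℤ
re+im z = re z +ℤ im z

re+im-+ᵍ : ∀ z w → re+im (z +ᵍ w) ≡ re+im z +ℤ re+im w
re+im-+ᵍ (a + b i) (c + d i) = rearrange a b c d
  where
  rearrange : ∀ a b c d → (a +ℤ c) +ℤ (b +ℤ d) ≡ (a +ℤ b) +ℤ (c +ℤ d)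
  rearrange = solve-∀

re+im-ω*ᵍ : ∀ z → re+im (ω *ᵍ z) ≡ + 2 *ℤ re z
re+im-ω*ᵍ (a + b i) = collect a b
  where
  collect : ∀ a b → (+ 1 *ℤ a -ℤ + 1 *ℤ b) +ℤ (+ 1 *ℤ b +ℤ + 1 *ℤ a) ≡ + 2 *ℤ a
  collect = solve-∀

im-re-ω*ᵍ : ∀ z → im (ω *ᵍ z) -ℤ re (ω *ᵍ z) ≡ + 2 *ℤ im z
im-re-ω*ᵍ (a + b i) = collect a b
  where
  collect : ∀ a b → (+ 1 *ℤ b +ℤ + 1 *ℤ a) -ℤ (+ 1 *ℤ a -ℤ + 1 *ℤ b) ≡ + 2 *ℤ b
  collect = solve-∀

ω*ᵍ-cancel : ∀ z w → ω *ᵍ z ≡ ω *ᵍ w → z ≡ w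
ω*ᵍ-cancel z@(a + b i) w@(c + d i) eq = +i-cong
  (*-cancelˡ-≡ (+ 2) a c (begin
    + 2 *ℤ a         ≡⟨ re+im-ω*ᵍ z ⟨
    re+im (ω *ᵍ z)   ≡⟨ cong re+im eq ⟩
    re+im (ω *ᵍ w)   ≡⟨ re+im-ω*ᵍ w ⟩
    + 2 *ℤ c         ∎))
  (*-cancelˡ-≡ (+ 2) b d (begin
    + 2 *ℤ b                     ≡⟨ im-re-ω*ᵍ z ⟨
    im (ω *ᵍ z) -ℤ re (ω *ᵍ z)   ≡⟨ cong (λ u → im u -ℤ re u) eq ⟩
    im (ω *ᵍ w) -ℤ re (ω *ᵍ w)   ≡⟨ im-re-ω*ᵍ w ⟩
    + 2 *ℤ d                     ∎))

digit≡d0⊎∣re+im∣≡1 : ∀ v → v ≡ d0 ⊎ ∣ re+im (digitVal v) ∣ ≡ 1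
digit≡d0⊎∣re+im∣≡1 d0  = inj₁ refl
digit≡d0⊎∣re+im∣≡1 d1  = inj₂ refl
digit≡d0⊎∣re+im∣≡1 d-1 = inj₂ refl
digit≡d0⊎∣re+im∣≡1 di  = inj₂ refl
digit≡d0⊎∣re+im∣≡1 d-i = inj₂ refl

digit+ω*ᵍ≡ω*ᵍ⇒d0 : ∀ v y q → digitVal v +ᵍ (ω *ᵍ y) ≡ ω *ᵍ q → v ≡ d0
digit+ω*ᵍ≡ω*ᵍ⇒d0 v y q eq with digit≡d0⊎∣re+im∣≡1 v
... | inj₁ v≡d0 = v≡d0
... | inj₂ odd  = ⊥-elim (∣n∣≡1⇒n≢2*m _ (re q -ℤ re y) odd
                           (n+2a≡2b⇒n≡2[b-a] (re+im (digitVal v)) (re y) (re q) re+im-eq))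
  where
  re+im-eq : re+im (digitVal v) +ℤ + 2 *ℤ re y ≡ + 2 *ℤ re q
  re+im-eq = begin
    re+im (digitVal v) +ℤ + 2 *ℤ re y          ≡⟨ cong (re+im (digitVal v) +ℤ_) (re+im-ω*ᵍ y) ⟨
    re+im (digitVal v) +ℤ re+im (ω *ᵍ y)       ≡⟨ re+im-+ᵍ (digitVal v) (ω *ᵍ y) ⟨
    re+im (digitVal v +ᵍ (ω *ᵍ y))             ≡⟨ cong re+im eq ⟩
    re+im (ω *ᵍ q)                             ≡⟨ re+im-ω*ᵍ q ⟩
    + 2 *ℤ re q                                ∎

expandFrom-suc : ∀ s {m} (vs : Vec Digit m) → expandFrom (suc s) vs ≡ ω *ᵍ expandFrom s vs
expandFrom-suc s [] = refl
expandFrom-suc s (v ∷ vs) = begin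
  (digitVal v *ᵍ (ω *ᵍ (ω ^ᵍ s))) +ᵍ expandFrom (suc (suc s)) vs
    ≡⟨ cong₂ _+ᵍ_ (*ᵍ-comm-middle (digitVal v) ω (ω ^ᵍ s)) (expandFrom-suc (suc s) vs) ⟩
  (ω *ᵍ (digitVal v *ᵍ (ω ^ᵍ s))) +ᵍ (ω *ᵍ expandFrom (suc s) vs)
    ≡⟨ *ᵍ-distribˡ-+ᵍ ω (digitVal v *ᵍ (ω ^ᵍ s)) (expandFrom (suc s) vs) ⟨
  ω *ᵍ ((digitVal v *ᵍ (ω ^ᵍ s)) +ᵍ expandFrom (suc s) vs)  ∎

expand-∷ : ∀ v {m} (vs : Vec Digit m) → expand (v ∷ vs) ≡ digitVal v +ᵍ (ω *ᵍ expand vs)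
expand-∷ v vs = cong₂ _+ᵍ_ (*ᵍ-identityʳ (digitVal v)) (expandFrom-suc 0 vs)

ω^-∣expand⇒≡0ᵍ : ∀ {m} (vs : Vec Digit m) → (ω ^ᵍ m) ∣ᵍ expand vs → expand vs ≡ 0ᵍ
ω^-∣expand⇒≡0ᵍ [] _ = refl
ω^-∣expand⇒≡0ᵍ {suc m} (v ∷ vs) (q , eq)
  with digit+ω*ᵍ≡ω*ᵍ⇒d0 v (expand vs) ((ω ^ᵍ m) *ᵍ q)
         (trans (sym (expand-∷ v vs)) (trans eq (*ᵍ-assoc ω (ω ^ᵍ m) q)))
... | refl = begin
  expand (d0 ∷ vs)          ≡⟨ expand-∷ d0 vs ⟩
  0ᵍ +ᵍ (ω *ᵍ expand vs)    ≡⟨ cong (λ y → 0ᵍ +ᵍ (ω *ᵍ y)) (ω^-∣expand⇒≡0ᵍ vs (q , ω^m∣vs)) ⟩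
  0ᵍ                        ∎
  where
  ω^m∣vs : expand vs ≡ (ω ^ᵍ m) *ᵍ q
  ω^m∣vs = ω*ᵍ-cancel _ _ (begin
    ω *ᵍ expand vs            ≡⟨ +ᵍ-identityˡ _ ⟨
    0ᵍ +ᵍ (ω *ᵍ expand vs)    ≡⟨ expand-∷ d0 vs ⟨
    expand (d0 ∷ vs)          ≡⟨ eq ⟩
    (ω *ᵍ (ω ^ᵍ m)) *ᵍ q      ≡⟨ *ᵍ-assoc ω (ω ^ᵍ m) q ⟩
    ω *ᵍ ((ω ^ᵍ m) *ᵍ q)      ∎)

mainTheorem2 : (k : ℕ) (x : ℤ[i]) → InB k x → (ω ^ᵍ suc k) ∣ᵍ x → x ≡ 0ᵍ
mainTheorem2 k x (v , refl) = ω^-∣expand⇒≡0ᵍ v
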